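{- For every integer $d \geq 1$, $c(d) \leq i(d) \leq b(d) \leq c(d+1)$, where $i(d)$ is the maximum number of edges of an invertibility critical hypergraph of degree $d$, $b(d)$ is the maximum cardinality of a minimal edge cover of degree $d$ of a complete bipartite graph, and $c(d)$ is the maximum cardinality of a minimal edge cover of degree $d$ of a complete graph.
   Context: A hypergraph $\mathbf{H} = (\mathcal{H}, V)$ consists of a finite vertex set $V$ and a family $\mathcal{H}$ of subsets of $V$ (the edges). $\mathbf{H}$ is invertible iff there exists a permutation $\pi$ of $V$ with $\pi(E) \cap E = \emptyset$ for all $E \in \mathcal{H}$, where $\pi(E)=\{\pi(x)\mid x\in E\}$. $\mathbf{H}$ is invertibility critical iff it is not invertible but $(\mathcal{H}\setminus\{E\}, V)$ is invertible for every $E \in \mathcal{H}$. A family $\mathcal{H}$ of subsets of a set $V$ has degree $d$ if every $x \in V$ belongs to at most $d$ members of $\mathcal{H}$. For a finite graph $G$, a family $\mathcal{H}$ of subsets of $V(G)$ is an edge cover of $G$ iff every edge $e$ of $G$ (viewed as a 2-element vertex set) is included in some $E \in \mathcal{H}$; it is a minimal edge cover iff no proper subfamily $\mathcal{H}' \subsetneq \mathcal{H}$ is an edge cover of $G$. -}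

module Defs where

open import Data.Nat using (ℕ; suc; _≤_)
open import Data.Fin using (Fin; splitAt)
open import Data.Fin.Subset using (Subset; _∈_; _∉_)
open import Data.Fin.Subset.Properties using (_∈?_)
open import Data.Fin.Permutation using (Permutation′; _⟨$⟩ʳ_)
open import Data.List using (List; filter; length; allFin)
open import Data.Sum using (_⊎_; inj₁; inj₂)
open import Data.Product using (Σ; _×_; ∃; ∃-syntax)
open import Relation.Binary.PropositionalEquality using (_≡_; _≢_)
open import Relation.Nullary using (¬_)
open import Function.Definitions using (Injective)

-- A family of m subsets of the vertex set V = Fin n, given by an
-- injective indexing  H : Fin m → Subset n  (so it is a genuine set of
-- m distinct subsets and has exactly m members).
Family : ℕ → ℕ → Set
Family m n = Fin m → Subset n

IsSetFamily : ∀ {m n} → Family m n → Set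
IsSetFamily H = Injective _≡_ _≡_ H

DisjointImage : ∀ {n} → Permutation′ n → Subset n → Set
DisjointImage {n} π E =
  ¬ (Σ (Fin n) λ y → (∃[ x ] (x ∈ E × π ⟨$⟩ʳ x ≡ y)) × y ∈ E)

Invertible : ∀ {m n} → Family m n → Set
Invertible {m} {n} H = ∃[ π ] (∀ (j : Fin m) → DisjointImage {n} π (H j))

InvertibleWithout : ∀ {m n} → Family m n → Fin m → Set
InvertibleWithout {m} {n} H j =
  ∃[ π ] (∀ (k : Fin m) → k ≢ j → DisjointImage {n} π (H k))

InvertibilityCritical : ∀ {m n} → Family m n → Set
InvertibilityCritical {m} H = ¬ Invertible H × (∀ (j : Fin m) → InvertibleWithout H j)

degreeAt : ∀ {m n} → Family m n → Fin n → ℕ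
degreeAt {m} H x = length (filter (λ j → x ∈? H j) (allFin m))

HasDegree : ∀ {m n} → ℕ → Family m n → Set
HasDegree {n = n} d H = ∀ (x : Fin n) → degreeAt H x ≤ d

Graph : ℕ → Set₁
Graph n = Fin n → Fin n → Set

CompleteGraph : (n : ℕ) → Graph n
CompleteGraph n x y = x ≢ y

IsLeft : ∀ {A B : Set} → A ⊎ B → Set
IsLeft (inj₁ _) = Data.Unit.⊤ where import Data.Unit
IsLeft (inj₂ _) = Data.Empty.⊥ where import Data.Empty

CompleteBipartiteGraph : (p q : ℕ) → Graph (p Data.Nat.+ q)
CompleteBipartiteGraph p q x y =
  (IsLeft (splitAt p x) × ¬ IsLeft (splitAt p y)) ⊎ (¬ IsLeft (splitAt p x) × IsLeft (splitAt p y))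

CoversWith : ∀ {m n} → Graph n → Family m n → Subset m → Set
CoversWith {m} {n} G H S =
  ∀ (x y : Fin n) → G x y → ∃[ j ] (j ∈ S × x ∈ H j × y ∈ H j)

EdgeCover : ∀ {m n} → Graph n → Family m n → Set
EdgeCover {m} {n} G H = ∀ (x y : Fin n) → G x y → ∃[ j ] (x ∈ H j × y ∈ H j)

MinimalEdgeCover : ∀ {m n} → Graph n → Family m n → Set
MinimalEdgeCover {m} G H =
  EdgeCover G H × (∀ (S : Subset m) → (∃[ j ] j ∉ S) → ¬ CoversWith G H S)

-- "k is attained": there is an object of the relevant kind with k edges/members.
-- i(d) = max { k | IAttained d k }, etc.
IAttained : ℕ → ℕ → Set
IAttained d k = ∃[ n ] Σ (Family k n) λ H →
  IsSetFamily H × HasDegree d H × InvertibilityCritical H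

BAttained : ℕ → ℕ → Set
BAttained d k = ∃[ p ] ∃[ q ] Σ (Family k (p Data.Nat.+ q)) λ H →
  IsSetFamily H × HasDegree d H × MinimalEdgeCover (CompleteBipartiteGraph p q) H

CAttained : ℕ → ℕ → Set
CAttained d k = ∃[ n ] Σ (Family k n) λ H →
  IsSetFamily H × HasDegree d H × MinimalEdgeCover (CompleteGraph n) H

-- sup A ≤ sup B  (as elements of ℕ ∪ {∞}): every attained value of A is
-- bounded by an attained value of B
_≼_ : (ℕ → Set) → (ℕ → Set) → Set
A ≼ B = ∀ k → A k → ∃[ k′ ] (k ≤ k′ × B k′)

-- A minimal edge cover is an edge cover in which every member has a private edge, one lying in
-- no other member; conversely private edges give minimality and distinctness of the members.
--
-- c(d) ≤ i(d): add n − 1 isolated vertices to a minimal cover of K_n (n ≥ 2). Any two old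
-- vertices, equal or not, share a member, so an inverting permutation would have to send the
-- n old vertices injectively to the n − 1 new ones. Once a member E is removed, the
-- permutation exchanging the ends of the private edge of E and pairing all other old vertices
-- with new ones inverts the rest.
--
-- i(d) ≤ b(d): call x, y separated if no member contains both. A permutation matching every
-- vertex with a separated one inverts H, so by Hall's theorem there is a set X with fewer
-- separated neighbours N(X) than elements. Every pair of X × Y, Y the complement of N(X), is
-- covered; and a permutation inverting H − E cannot inject X into N(X), so some pair of
-- X × Y is covered by E alone. Hence the members restricted to copies of X and Y form a
-- minimal cover of K_{|X|,|Y|}.
--
-- b(d) ≤ c(d + 1): adding the two sides of K_{p,q} as members (each only if some pair in it is
-- still uncovered) gives a minimal cover of K_{p+q}, raising every degree by at most one.

module Submission where

open import Level using (0ℓ)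
open import Defs
open import Data.Nat using (ℕ; zero; suc; _≤_; _<_; _+_; z≤n; s≤s)
open import Data.Nat.Properties
  using (module ≤-Reasoning; ≤-refl; ≤-trans; ≤-reflexive; ≤-<-trans; n≤1+n; 1+n≰n; <⇒≱; _≤?_;
         +-suc; +-comm; +-mono-≤-<)
open import Data.Fin using (Fin; zero; suc; splitAt; join; _↑ˡ_; _↑ʳ_; punchIn; punchOut)
open import Data.Fin.Properties
  using (_≟_; any?; all?; ¬∀⟶∃¬; suc-injective; injective⇒≤; ↑ˡ-injective;
         punchInᵢ≢i; punchOut-cong; punchOut-injective; punchIn-punchOut; punchOut-punchIn;
         splitAt-↑ˡ; splitAt-↑ʳ; splitAt⁻¹-↑ˡ; splitAt⁻¹-↑ʳ; splitAt-join; join-splitAt)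
open import Data.Fin.Subset
  using (Subset; _∈_; _∉_; _⊆_; _⊂_; ⁅_⁆; ∁; _∪_; _─_; _-_; ∣_∣; ⊤; ⊥; Nonempty; Empty; inside; outside)
open import Data.Fin.Subset.Properties
  using (_∈?_; _⊂?_; nonempty?; anySubset?; Empty-unique; ∣⊥∣≡0; ∣⁅x⁆∣≡1; p⊆q⇒∣p∣≤∣q∣; ∉⊥; ∈⊤;
         x∈⁅x⁆; x∈⁅y⁆⇒x≡y; x≢y⇒x∉⁅y⁆; x∈p⇒x∉∁p; x∉p⇒x∈∁p; x∈∁p⇒x∉p; x∉∁p⇒x∈p;
         x∈p∪q⁻; x∈p∪q⁺; x∈p∩q⁺; x∈p∧x∉q⇒x∈p─q; x∈p∧x≢y⇒x∈p-y; p─q⊆p; p∩q≢∅⇒p─q⊂p; x∈p⇒p-x⊂p)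
open import Data.Fin.Subset.Induction using (⊂-wellFounded)
open import Data.Fin.Permutation as Perm using (Permutation′; _⟨$⟩ʳ_; permutation)
open import Function.Bundles using (Injection)
open import Function.Properties.Inverse using (↔⇒↣)
open import Data.Vec using ([]; _∷_; _++_; tabulate; here; there)
open import Data.Vec.Properties using (lookup∘tabulate; lookup⇒[]=; []=⇒lookup; ++-injectiveˡ)
open import Data.Vec.Functional using () renaming (_∷_ to _∷ᶠ_)
open import Data.List as List using (length; filter)
open import Data.List.Properties using (filter-none)
import Data.List.Relation.Unary.All.Properties as Allₚ
open import Data.Product using (Σ; _×_; _,_; proj₁; proj₂; ∃; ∃₂; ∃-syntax)
open import Data.Sum using (_⊎_; inj₁; inj₂; [_,_]′)
open import Data.Unit using (tt)
open import Function using (_∘_)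
open import Function.Definitions using (Injective)
import Induction.WellFounded as WF
open import Relation.Binary using (REL; Decidable; _⇒_)
open import Relation.Binary.PropositionalEquality
  using (_≡_; _≢_; refl; sym; trans; cong; subst; subst₂; module ≡-Reasoning)
open import Relation.Nullary using (¬_; Dec; yes; no; does; contradiction)
open import Relation.Nullary.Decidable using (_×-dec_; _→-dec_; _⊎-dec_; ¬?; dec-true)

⟦_⟧ : ∀ {n} {P : Fin n → Set} → (∀ x → Dec (P x)) → Subset n
⟦ P? ⟧ = tabulate (λ x → does (P? x))

∈⟦⟧⁺ : ∀ {n} {P : Fin n → Set} (P? : ∀ x → Dec (P x)) {x} → P x → x ∈ ⟦ P? ⟧
∈⟦⟧⁺ P? {x} px = lookup⇒[]= x _ (trans (lookup∘tabulate _ x) (dec-true (P? x) px))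

∈⟦⟧⁻ : ∀ {n} {P : Fin n → Set} (P? : ∀ x → Dec (P x)) {x} → x ∈ ⟦ P? ⟧ → P x
∈⟦⟧⁻ P? {x} x∈ with P? x | trans (sym (lookup∘tabulate _ x)) ([]=⇒lookup x∈)
... | yes px | _ = px
... | no _   | ()

x∈p─q⇒x∉q : ∀ {n} (p q : Subset n) {x} → x ∈ p ─ q → x ∉ q
x∈p─q⇒x∉q (_ ∷ p) (inside  ∷ q) {zero}  ()        _
x∈p─q⇒x∉q (_ ∷ p) (outside ∷ q) {zero}  _         ()
x∈p─q⇒x∉q (_ ∷ p) (_       ∷ q) {suc x} (there h) (there h′) = x∈p─q⇒x∉q p q h h′

empty⇒∣p∣≡0 : ∀ {n} {p : Subset n} → Empty p → ∣ p ∣ ≡ 0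
empty⇒∣p∣≡0 {n} e = trans (cong ∣_∣ (Empty-unique e)) (∣⊥∣≡0 n)

∣p∪q∣≤∣p∣+∣q∣ : ∀ {n} (p q : Subset n) → ∣ p ∪ q ∣ ≤ ∣ p ∣ + ∣ q ∣
∣p∪q∣≤∣p∣+∣q∣ []            []            = z≤n
∣p∪q∣≤∣p∣+∣q∣ (inside  ∷ p) (inside  ∷ q) =
  s≤s (≤-trans (∣p∪q∣≤∣p∣+∣q∣ p q) (≤-trans (n≤1+n _) (≤-reflexive (sym (+-suc ∣ p ∣ ∣ q ∣)))))
∣p∪q∣≤∣p∣+∣q∣ (inside  ∷ p) (outside ∷ q) = s≤s (∣p∪q∣≤∣p∣+∣q∣ p q)
∣p∪q∣≤∣p∣+∣q∣ (outside ∷ p) (inside  ∷ q) =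
  ≤-trans (s≤s (∣p∪q∣≤∣p∣+∣q∣ p q)) (≤-reflexive (sym (+-suc ∣ p ∣ ∣ q ∣)))
∣p∪q∣≤∣p∣+∣q∣ (outside ∷ p) (outside ∷ q) = ∣p∪q∣≤∣p∣+∣q∣ p q

disjoint⇒∣p∪q∣≡∣p∣+∣q∣ : ∀ {n} (p q : Subset n) → (∀ {x} → x ∈ p → x ∉ q) → ∣ p ∪ q ∣ ≡ ∣ p ∣ + ∣ q ∣
disjoint⇒∣p∪q∣≡∣p∣+∣q∣ []            []            _    = refl
disjoint⇒∣p∪q∣≡∣p∣+∣q∣ (inside  ∷ p) (inside  ∷ q) disj = contradiction here (disj here)
disjoint⇒∣p∪q∣≡∣p∣+∣q∣ (inside  ∷ p) (outside ∷ q) disj =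
  cong suc (disjoint⇒∣p∪q∣≡∣p∣+∣q∣ p q (λ x∈p x∈q → disj (there x∈p) (there x∈q)))
disjoint⇒∣p∪q∣≡∣p∣+∣q∣ (outside ∷ p) (inside  ∷ q) disj =
  trans (cong suc (disjoint⇒∣p∪q∣≡∣p∣+∣q∣ p q (λ x∈p x∈q → disj (there x∈p) (there x∈q))))
        (sym (+-suc ∣ p ∣ ∣ q ∣))
disjoint⇒∣p∪q∣≡∣p∣+∣q∣ (outside ∷ p) (outside ∷ q) disj =
  disjoint⇒∣p∪q∣≡∣p∣+∣q∣ p q (λ x∈p x∈q → disj (there x∈p) (there x∈q))

enum : ∀ {n} (p : Subset n) → Fin ∣ p ∣ → Fin n
enum (inside  ∷ p) zero    = zero
enum (inside  ∷ p) (suc i) = suc (enum p i)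
enum (outside ∷ p) i       = suc (enum p i)

enum-∈ : ∀ {n} (p : Subset n) i → enum p i ∈ p
enum-∈ (inside  ∷ p) zero    = here
enum-∈ (inside  ∷ p) (suc i) = there (enum-∈ p i)
enum-∈ (outside ∷ p) i       = there (enum-∈ p i)

enum-injective : ∀ {n} (p : Subset n) → Injective _≡_ _≡_ (enum p)
enum-injective (inside  ∷ p) {zero}  {zero}  _  = refl
enum-injective (inside  ∷ p) {suc i} {suc j} eq = cong suc (enum-injective p (suc-injective eq))
enum-injective (outside ∷ p)                 eq = enum-injective p (suc-injective eq)

index : ∀ {n} (p : Subset n) {x} → x ∈ p → Fin ∣ p ∣
index (inside  ∷ p) here          = zero
index (inside  ∷ p) (there x∈p)   = suc (index p x∈p)
index (outside ∷ p) (there x∈p)   = index p x∈p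

enum-index : ∀ {n} (p : Subset n) {x} (x∈p : x ∈ p) → enum p (index p x∈p) ≡ x
enum-index (inside  ∷ p) here        = refl
enum-index (inside  ∷ p) (there x∈p) = cong suc (enum-index p x∈p)
enum-index (outside ∷ p) (there x∈p) = cong suc (enum-index p x∈p)

injectiveOn⇒∣p∣≤∣q∣ : ∀ {n n′} {p : Subset n} {q : Subset n′} (f : Fin n → Fin n′) →
  (∀ {x} → x ∈ p → f x ∈ q) → (∀ {x y} → x ∈ p → y ∈ p → f x ≡ f y → x ≡ y) → ∣ p ∣ ≤ ∣ q ∣
injectiveOn⇒∣p∣≤∣q∣ {p = p} {q} f f∈q f-inj = injective⇒≤ restriction-injective
  where
  restriction : Fin ∣ p ∣ → Fin ∣ q ∣
  restriction i = index q (f∈q (enum-∈ p i))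

  restriction-injective : Injective _≡_ _≡_ restriction
  restriction-injective {i} {j} eq = enum-injective p (f-inj (enum-∈ p i) (enum-∈ p j) (begin
    f (enum p i)           ≡⟨ enum-index q (f∈q (enum-∈ p i)) ⟨
    enum q (restriction i) ≡⟨ cong (enum q) eq ⟩
    enum q (restriction j) ≡⟨ enum-index q (f∈q (enum-∈ p j)) ⟩
    f (enum p j)           ∎))
    where open ≡-Reasoning

injective⇒surjective : ∀ {n} (f : Fin n → Fin n) → Injective _≡_ _≡_ f → ∀ y → ∃[ x ] f x ≡ y
injective⇒surjective {suc n} f f-inj y with any? (λ x → f x ≟ y)
... | yes hit = hit
... | no miss = contradiction (injective⇒≤ squeezed-injective) 1+n≰n
  where
  squeezed : Fin (suc n) → Fin n
  squeezed x = punchOut {i = y} (λ y≡fx → miss (x , sym y≡fx))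

  squeezed-injective : Injective _≡_ _≡_ squeezed
  squeezed-injective {a} {b} eq =
    f-inj (punchOut-injective {i = y} (λ y≡fa → miss (a , sym y≡fa)) (λ y≡fb → miss (b , sym y≡fb)) eq)

injective⇒permutation : ∀ {n} (f : Fin n → Fin n) → Injective _≡_ _≡_ f →
  Σ (Permutation′ n) λ π → ∀ x → π ⟨$⟩ʳ x ≡ f x
injective⇒permutation f f-inj =
  permutation f (proj₁ ∘ surj) (proj₂ ∘ surj) (λ x → f-inj (proj₂ (surj (f x)))) , λ _ → refl
  where
  surj = injective⇒surjective f f-inj

¬∀₂⟶∃₂¬ : ∀ {n} {R : Fin n → Fin n → Set} → Decidable R → ¬ (∀ x y → R x y) → ∃₂ λ x y → ¬ R x y
¬∀₂⟶∃₂¬ {n} {R} R? ¬all =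
  let x , ¬allˣ = ¬∀⟶∃¬ n (λ x → ∀ y → R x y) (λ x → all? (R? x)) (λ all → ¬all (λ x → all x))
      y , ¬r    = ¬∀⟶∃¬ n (R x) (R? x) ¬allˣ
  in x , y , ¬r

¬→⇒×¬ : ∀ {A B : Set} → Dec A → ¬ (A → B) → A × ¬ B
¬→⇒×¬ (yes a) ¬[a→b] = a , λ b → ¬[a→b] (λ _ → b)
¬→⇒×¬ (no ¬a) ¬[a→b] = contradiction (λ a → contradiction a ¬a) ¬[a→b]

module Hall {m n} (A : REL (Fin m) (Fin n) 0ℓ) (A? : Decidable A) where

  Nb : Subset n → Subset m → Subset n
  Nb R X = ⟦ (λ y → y ∈? R ×-dec any? (λ x → x ∈? X ×-dec A? x y)) ⟧

  Nb⁺ : ∀ {R X x y} → y ∈ R → x ∈ X → A x y → y ∈ Nb R X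
  Nb⁺ {R} {X} y∈R x∈X xAy = ∈⟦⟧⁺ (λ y → y ∈? R ×-dec any? (λ x → x ∈? X ×-dec A? x y)) (y∈R , _ , x∈X , xAy)

  Nb⁻ : ∀ {R X y} → y ∈ Nb R X → y ∈ R × ∃[ x ] (x ∈ X × A x y)
  Nb⁻ {R} {X} = ∈⟦⟧⁻ (λ y → y ∈? R ×-dec any? (λ x → x ∈? X ×-dec A? x y))

  record Matching (L : Subset m) (R : Subset n) : Set where
    field
      match           : ∀ {x} → x ∈ L → Fin n
      match-∈         : ∀ {x} (x∈L : x ∈ L) → match x∈L ∈ R
      match-related   : ∀ {x} (x∈L : x ∈ L) → A x (match x∈L)
      match-injective : ∀ {x x′} (x∈L : x ∈ L) (x′∈L : x′ ∈ L) → match x∈L ≡ match x′∈L → x ≡ x′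

  Deficient : Subset m → Subset n → Set
  Deficient L R = ∃[ X ] (X ⊆ L × ∣ Nb R X ∣ < ∣ X ∣)

  Tight : Subset m → Subset n → Subset m → Set
  Tight L R X = X ⊂ L × Nonempty X × ∣ Nb R X ∣ ≤ ∣ X ∣

  tight? : ∀ L R X → Dec (Tight L R X)
  tight? L R X = X ⊂? L ×-dec nonempty? X ×-dec ∣ Nb R X ∣ ≤? ∣ X ∣

  empty-matching : ∀ {L R} → Empty L → Matching L R
  empty-matching empty = record
    { match           = λ x∈L → contradiction (_ , x∈L) empty
    ; match-∈         = λ x∈L → contradiction (_ , x∈L) empty
    ; match-related   = λ x∈L → contradiction (_ , x∈L) empty
    ; match-injective = λ x∈L _ _ → contradiction (_ , x∈L) empty
    }

  singleton-matching : ∀ {x y} → A x y → Matching ⁅ x ⁆ ⁅ y ⁆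
  singleton-matching {x} {y} xAy = record
    { match           = λ _ → y
    ; match-∈         = λ _ → x∈⁅x⁆ y
    ; match-related   = λ x′∈⁅x⁆ → subst (λ x′ → A x′ y) (sym (x∈⁅y⁆⇒x≡y x x′∈⁅x⁆)) xAy
    ; match-injective = λ x₁∈⁅x⁆ x₂∈⁅x⁆ _ → trans (x∈⁅y⁆⇒x≡y x x₁∈⁅x⁆) (sym (x∈⁅y⁆⇒x≡y x x₂∈⁅x⁆))
    }

  matching-join : ∀ {L L₁ R R₁} → R₁ ⊆ R → Matching L₁ R₁ → Matching (L ─ L₁) (R ─ R₁) → Matching L R
  matching-join {L} {L₁} {R} {R₁} R₁⊆R M₁ M₂ = record
    { match = match ; match-∈ = match-∈ ; match-related = match-related ; match-injective = match-injective }
    where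
    module M₁ = Matching M₁
    module M₂ = Matching M₂

    match : ∀ {x} → x ∈ L → Fin n
    match {x} x∈L with x ∈? L₁
    ... | yes x∈L₁ = M₁.match x∈L₁
    ... | no  x∉L₁ = M₂.match (x∈p∧x∉q⇒x∈p─q x∈L x∉L₁)

    match-∈ : ∀ {x} (x∈L : x ∈ L) → match x∈L ∈ R
    match-∈ {x} x∈L with x ∈? L₁
    ... | yes x∈L₁ = R₁⊆R (M₁.match-∈ x∈L₁)
    ... | no  x∉L₁ = p─q⊆p R R₁ (M₂.match-∈ _)

    match-related : ∀ {x} (x∈L : x ∈ L) → A x (match x∈L)
    match-related {x} x∈L with x ∈? L₁
    ... | yes x∈L₁ = M₁.match-related x∈L₁
    ... | no  x∉L₁ = M₂.match-related _

    match-injective : ∀ {x x′} (x∈L : x ∈ L) (x′∈L : x′ ∈ L) → match x∈L ≡ match x′∈L → x ≡ x′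
    match-injective {x} {x′} x∈L x′∈L eq with x ∈? L₁ | x′ ∈? L₁
    ... | yes x∈L₁ | yes x′∈L₁ = M₁.match-injective x∈L₁ x′∈L₁ eq
    ... | no  x∉L₁ | no  x′∉L₁ = M₂.match-injective _ _ eq
    ... | yes x∈L₁ | no  x′∉L₁ =
      contradiction (subst (_∈ R₁) eq (M₁.match-∈ x∈L₁)) (x∈p─q⇒x∉q R R₁ (M₂.match-∈ _))
    ... | no  x∉L₁ | yes x′∈L₁ =
      contradiction (subst (_∈ R₁) (sym eq) (M₁.match-∈ x′∈L₁)) (x∈p─q⇒x∉q R R₁ (M₂.match-∈ _))

  deficient-inside : ∀ {L R X} → X ⊆ L → Deficient X (Nb R X) → Deficient L R
  deficient-inside {R = R} {X} X⊆L (X′ , X′⊆X , X′-deficient) =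
    X′ , X⊆L ∘ X′⊆X , ≤-<-trans (p⊆q⇒∣p∣≤∣q∣ Nb-X′⊆) X′-deficient
    where
    Nb-X′⊆ : Nb R X′ ⊆ Nb (Nb R X) X′
    Nb-X′⊆ y∈Nb with Nb⁻ y∈Nb
    ... | y∈R , x , x∈X′ , xAy = Nb⁺ (Nb⁺ y∈R (X′⊆X x∈X′) xAy) x∈X′ xAy

  deficient-outside : ∀ {L R X} → Tight L R X → Deficient (L ─ X) (R ─ Nb R X) → Deficient L R
  deficient-outside {L} {R} {X} ((X⊆L , _) , _ , X-tight) (Z , Z⊆L─X , Z-deficient) =
    X ∪ Z , X∪Z⊆L , (begin-strict
      ∣ Nb R (X ∪ Z) ∣                   ≤⟨ p⊆q⇒∣p∣≤∣q∣ Nb-X∪Z⊆ ⟩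
      ∣ Nb R X ∪ Nb (R ─ Nb R X) Z ∣     ≤⟨ ∣p∪q∣≤∣p∣+∣q∣ (Nb R X) _ ⟩
      ∣ Nb R X ∣ + ∣ Nb (R ─ Nb R X) Z ∣ <⟨ +-mono-≤-< X-tight Z-deficient ⟩
      ∣ X ∣ + ∣ Z ∣                      ≡⟨ disjoint⇒∣p∪q∣≡∣p∣+∣q∣ X Z X-Z-disjoint ⟨
      ∣ X ∪ Z ∣                          ∎)
    where
    open ≤-Reasoning
    X-Z-disjoint : ∀ {x} → x ∈ X → x ∉ Z
    X-Z-disjoint x∈X x∈Z = x∈p─q⇒x∉q L X (Z⊆L─X x∈Z) x∈X

    X∪Z⊆L : X ∪ Z ⊆ L
    X∪Z⊆L x∈X∪Z with x∈p∪q⁻ X Z x∈X∪Z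
    ... | inj₁ x∈X = X⊆L x∈X
    ... | inj₂ x∈Z = p─q⊆p L X (Z⊆L─X x∈Z)

    Nb-X∪Z⊆ : Nb R (X ∪ Z) ⊆ Nb R X ∪ Nb (R ─ Nb R X) Z
    Nb-X∪Z⊆ {y} y∈Nb with Nb⁻ y∈Nb
    ... | y∈R , x , x∈X∪Z , xAy with y ∈? Nb R X | x∈p∪q⁻ X Z x∈X∪Z
    ...   | yes y∈NbX | _        = x∈p∪q⁺ (inj₁ y∈NbX)
    ...   | no  y∉NbX | inj₁ x∈X = contradiction (Nb⁺ y∈R x∈X xAy) y∉NbX
    ...   | no  y∉NbX | inj₂ x∈Z = x∈p∪q⁺ (inj₂ (Nb⁺ (x∈p∧x∉q⇒x∈p─q y∈R y∉NbX) x∈Z xAy))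

  isolated⇒deficient : ∀ {L R x} → x ∈ L → (∀ {y} → y ∈ R → ¬ A x y) → Deficient L R
  isolated⇒deficient {L} {R} {x} x∈L isolated =
    ⁅ x ⁆ , ⁅x⁆⊆L , subst₂ _<_ (sym (empty⇒∣p∣≡0 no-neighbour)) (sym (∣⁅x⁆∣≡1 x)) (s≤s z≤n)
    where
    ⁅x⁆⊆L : ⁅ x ⁆ ⊆ L
    ⁅x⁆⊆L x′∈⁅x⁆ = subst (_∈ L) (sym (x∈⁅y⁆⇒x≡y x x′∈⁅x⁆)) x∈L

    no-neighbour : Empty (Nb R ⁅ x ⁆)
    no-neighbour (y , y∈Nb) with Nb⁻ y∈Nb
    ... | y∈R , x′ , x′∈⁅x⁆ , x′Ay = isolated y∈R (subst (λ x′ → A x′ y) (x∈⁅y⁆⇒x≡y x x′∈⁅x⁆) x′Ay)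

  deficient-removal⇒tight : ∀ {L R x y} → x ∈ L → Deficient (L - x) (R - y) → ∃ (Tight L R)
  deficient-removal⇒tight {L} {R} {x} {y} x∈L (X , X⊆L-x , X-deficient) =
    X , (p─q⊆p L ⁅ x ⁆ ∘ X⊆L-x , x , x∈L , x∉X) , X-nonempty , (begin
      ∣ Nb R X ∣                   ≤⟨ p⊆q⇒∣p∣≤∣q∣ Nb-X⊆ ⟩
      ∣ Nb (R - y) X ∪ ⁅ y ⁆ ∣     ≤⟨ ∣p∪q∣≤∣p∣+∣q∣ (Nb (R - y) X) ⁅ y ⁆ ⟩
      ∣ Nb (R - y) X ∣ + ∣ ⁅ y ⁆ ∣ ≡⟨ cong (∣ Nb (R - y) X ∣ +_) (∣⁅x⁆∣≡1 y) ⟩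
      ∣ Nb (R - y) X ∣ + 1         ≡⟨ +-comm _ 1 ⟩
      suc ∣ Nb (R - y) X ∣         ≤⟨ X-deficient ⟩
      ∣ X ∣                        ∎)
    where
    open ≤-Reasoning
    x∉X : x ∉ X
    x∉X x∈X = x∈p─q⇒x∉q L ⁅ x ⁆ (X⊆L-x x∈X) (x∈⁅x⁆ x)

    X-nonempty : Nonempty X
    X-nonempty with nonempty? X
    ... | yes nonempty = nonempty
    ... | no  empty    = contradiction (subst (∣ Nb (R - y) X ∣ <_) (empty⇒∣p∣≡0 empty) X-deficient) λ ()

    Nb-X⊆ : Nb R X ⊆ Nb (R - y) X ∪ ⁅ y ⁆
    Nb-X⊆ {y′} y′∈Nb with Nb⁻ y′∈Nb | y′ ≟ y
    ... | _                       | yes refl = x∈p∪q⁺ (inj₂ (x∈⁅x⁆ y))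
    ... | y′∈R , _ , x′∈X , x′Ay′ | no  y′≢y = x∈p∪q⁺ (inj₁ (Nb⁺ (x∈p∧x≢y⇒x∈p-y y′∈R y′≢y) x′∈X x′Ay′))

  -- Halmos–Vaughan: split L along a proper tight subset if there is one; otherwise every proper
  -- nonempty X ⊆ L has a spare neighbour, so any pair x A y can be matched and the rest recursed on.
  hall : ∀ L R → Matching L R ⊎ Deficient L R
  hall = WF.All.wfRec ⊂-wellFounded 0ℓ (λ L → ∀ R → Matching L R ⊎ Deficient L R) step
    where
    step : ∀ L → (∀ {L′} → L′ ⊂ L → ∀ R → Matching L′ R ⊎ Deficient L′ R) → ∀ R → Matching L R ⊎ Deficient L R
    step L rec R with nonempty? L
    ... | no empty = inj₁ (empty-matching empty)
    ... | yes (x , x∈L) with anySubset? (tight? L R)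
    ...   | yes (X , X-tight@(X⊂L@(X⊆L , _) , (x′ , x′∈X) , _)) =
      split (rec X⊂L (Nb R X)) (rec (p∩q≢∅⇒p─q⊂p L X (x′ , x∈p∩q⁺ (X⊆L x′∈X , x′∈X))) (R ─ Nb R X))
      where
      split : Matching X (Nb R X) ⊎ Deficient X (Nb R X) →
              Matching (L ─ X) (R ─ Nb R X) ⊎ Deficient (L ─ X) (R ─ Nb R X) →
              Matching L R ⊎ Deficient L R
      split (inj₂ X-deficient) _                  = inj₂ (deficient-inside X⊆L X-deficient)
      split (inj₁ _)           (inj₂ L─X-deficient) = inj₂ (deficient-outside X-tight L─X-deficient)
      split (inj₁ M₁)          (inj₁ M₂)          = inj₁ (matching-join (proj₁ ∘ Nb⁻) M₁ M₂)
    ...   | no no-tight with any? (λ y → y ∈? R ×-dec A? x y)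
    ...     | no isolated = inj₂ (isolated⇒deficient x∈L (λ y∈R xAy → isolated (_ , y∈R , xAy)))
    ...     | yes (y , y∈R , xAy) with rec (x∈p⇒p-x⊂p x∈L) (R - y)
    ...       | inj₁ M   = inj₁ (matching-join ⁅y⁆⊆R (singleton-matching xAy) M)
      where
      ⁅y⁆⊆R : ⁅ y ⁆ ⊆ R
      ⁅y⁆⊆R y′∈⁅y⁆ = subst (_∈ R) (sym (x∈⁅y⁆⇒x≡y y y′∈⁅y⁆)) y∈R
    ...       | inj₂ L-x-deficient = contradiction (deficient-removal⇒tight x∈L L-x-deficient) no-tight

Covered : ∀ {m n} → Family m n → Fin n → Fin n → Set
Covered H x y = ∃[ j ] (x ∈ H j × y ∈ H j)

covered? : ∀ {m n} (H : Family m n) → Decidable (Covered H)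
covered? H x y = any? (λ j → x ∈? H j ×-dec y ∈? H j)

PrivatePair : ∀ {m n} → Family m n → Fin m → Fin n → Fin n → Set
PrivatePair H j x y = x ∈ H j × y ∈ H j × (∀ j′ → x ∈ H j′ → y ∈ H j′ → j′ ≡ j)

HasPrivateEdges : ∀ {m n} → Graph n → Family m n → Set
HasPrivateEdges G H = ∀ j → ∃₂ λ x y → G x y × PrivatePair H j x y

privateEdges-mono : ∀ {m n} {G G′ : Graph n} {H : Family m n} →
  G ⇒ G′ → HasPrivateEdges G H → HasPrivateEdges G′ H
privateEdges-mono G⇒G′ private-edges j =
  let x , y , xGy , private-xy = private-edges j in x , y , G⇒G′ xGy , private-xy

privateEdges⇒minimal : ∀ {m n} {G : Graph n} {H : Family m n} →
  EdgeCover G H → HasPrivateEdges G H → MinimalEdgeCover G H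
privateEdges⇒minimal cover private-edges = cover , λ S (j , j∉S) S-covers →
  let x , y , xGy , _ , _ , only-j = private-edges j
      j′ , j′∈S , x∈Hj′ , y∈Hj′    = S-covers x y xGy
  in j∉S (subst (_∈ S) (only-j j′ x∈Hj′ y∈Hj′) j′∈S)

privateEdges⇒setFamily : ∀ {m n} {G : Graph n} {H : Family m n} → HasPrivateEdges G H → IsSetFamily H
privateEdges⇒setFamily private-edges {j} {j′} Hj≡Hj′ =
  let _ , _ , _ , x∈Hj , y∈Hj , only-j = private-edges j
  in sym (only-j j′ (subst (_ ∈_) Hj≡Hj′ x∈Hj) (subst (_ ∈_) Hj≡Hj′ y∈Hj))

coveredOnlyBy⇒privatePair : ∀ {m n} {H : Family m n} {j x y} → Covered H x y →
  ¬ (∃[ j′ ] (j′ ≢ j × x ∈ H j′ × y ∈ H j′)) → PrivatePair H j x y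
coveredOnlyBy⇒privatePair {H = H} {j} {x} {y} (j′ , x∈Hj′ , y∈Hj′) ¬others =
  let j′≡j = only-j j′ x∈Hj′ y∈Hj′
  in subst (λ j → x ∈ H j) j′≡j x∈Hj′ , subst (λ j → y ∈ H j) j′≡j y∈Hj′ , only-j
  where
  only-j : ∀ j′ → x ∈ H j′ → y ∈ H j′ → j′ ≡ j
  only-j j′ x∈Hj′ y∈Hj′ with j′ ≟ j
  ... | yes j′≡j = j′≡j
  ... | no  j′≢j = contradiction (j′ , j′≢j , x∈Hj′ , y∈Hj′) ¬others

minimal⇒privateEdges : ∀ {m n} {G : Graph n} {H : Family m n} →
  Decidable G → MinimalEdgeCover G H → HasPrivateEdges G H
minimal⇒privateEdges {G = G} {H} G? (cover , minimal) j =
  let x , y , ¬coveredByOthers =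
        ¬∀₂⟶∃₂¬ (λ x y → G? x y →-dec any? (λ j′ → j′ ∈? ∁ ⁅ j ⁆ ×-dec x ∈? H j′ ×-dec y ∈? H j′))
                (minimal (∁ ⁅ j ⁆) (j , x∈p⇒x∉∁p (x∈⁅x⁆ j)))
      xGy , ¬others = ¬→⇒×¬ (G? x y) ¬coveredByOthers
  in x , y , xGy , coveredOnlyBy⇒privatePair (cover x y xGy) (λ (j′ , j′≢j , x∈Hj′ , y∈Hj′) →
                     ¬others (j′ , x∉p⇒x∈∁p (x≢y⇒x∉⁅y⁆ j′≢j) , x∈Hj′ , y∈Hj′))

count-tabulate-mono : ∀ {A B : Set} {P : A → Set} {Q : B → Set} (P? : ∀ a → Dec (P a)) (Q? : ∀ b → Dec (Q b))
  {k} (f : Fin k → A) (g : Fin k → B) → (∀ i → P (f i) → Q (g i)) →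
  length (filter P? (List.tabulate f)) ≤ length (filter Q? (List.tabulate g))
count-tabulate-mono P? Q? {zero}  f g P⇒Q = z≤n
count-tabulate-mono P? Q? {suc k} f g P⇒Q with P? (f zero) | Q? (g zero)
... | yes p | yes _ = s≤s (count-tabulate-mono P? Q? (f ∘ suc) (g ∘ suc) (P⇒Q ∘ suc))
... | yes p | no ¬q = contradiction (P⇒Q zero p) ¬q
... | no _  | yes _ = ≤-trans (count-tabulate-mono P? Q? (f ∘ suc) (g ∘ suc) (P⇒Q ∘ suc)) (n≤1+n _)
... | no _  | no _  = count-tabulate-mono P? Q? (f ∘ suc) (g ∘ suc) (P⇒Q ∘ suc)

degreeAt-mono : ∀ {m n n′} (H : Family m n) (H′ : Family m n′) {x y} →
  (∀ j → x ∈ H j → y ∈ H′ j) → degreeAt H x ≤ degreeAt H′ y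
degreeAt-mono H H′ {x} {y} = count-tabulate-mono (λ j → x ∈? H j) (λ j → y ∈? H′ j) (λ j → j) (λ j → j)

degreeAt-∷ : ∀ {m n} (E : Subset n) (H : Family m n) x → degreeAt (E ∷ᶠ H) x ≤ suc (degreeAt H x)
degreeAt-∷ E H x with x ∈? E
... | yes _ = s≤s (count-tabulate-mono _ (λ j → x ∈? H j) suc (λ j → j) (λ _ x∈ → x∈))
... | no _  = ≤-trans (count-tabulate-mono _ (λ j → x ∈? H j) suc (λ j → j) (λ _ x∈ → x∈)) (n≤1+n _)

degreeAt-∷-∉ : ∀ {m n} (E : Subset n) (H : Family m n) {x} → x ∉ E → degreeAt (E ∷ᶠ H) x ≤ degreeAt H x
degreeAt-∷-∉ E H {x} x∉E with x ∈? E
... | yes x∈E = contradiction x∈E x∉E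
... | no _    = count-tabulate-mono _ (λ j → x ∈? H j) suc (λ j → j) (λ _ x∈ → x∈)

degreeAt-isolated : ∀ {m n} (H : Family m n) {x} → (∀ j → x ∉ H j) → degreeAt H x ≡ 0
degreeAt-isolated H {x} isolated = cong length (filter-none (λ j → x ∈? H j) (Allₚ.tabulate⁺ isolated))

-- c(d) ≤ i(d)

pad : ∀ {n} k → Subset n → Subset (n + k)
pad k E = E ++ ⊥

↑ˡ-∈-pad : ∀ {n k} {E : Subset n} {v} → v ∈ E → v ↑ˡ k ∈ pad k E
↑ˡ-∈-pad here        = here
↑ˡ-∈-pad (there v∈E) = there (↑ˡ-∈-pad v∈E)

∈-pad⁻ : ∀ {n k} (E : Subset n) {w} → w ∈ pad k E → ∃[ v ] (v ↑ˡ k ≡ w × v ∈ E)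
∈-pad⁻ []      w∈⊥ = contradiction w∈⊥ ∉⊥
∈-pad⁻ (_ ∷ E) here = zero , refl , here
∈-pad⁻ (_ ∷ E) (there w∈pad) = let v , v↑≡w , v∈E = ∈-pad⁻ E w∈pad in suc v , cong suc v↑≡w , there v∈E

↑ʳ-∉-pad : ∀ {n k} (E : Subset n) t → n ↑ʳ t ∉ pad k E
↑ʳ-∉-pad []      t t∈⊥           = ∉⊥ t∈⊥
↑ʳ-∉-pad (_ ∷ E) t (there t∈pad) = ↑ʳ-∉-pad E t t∈pad

pad-degree : ∀ {m n k d} (H : Family m n) → HasDegree d H → HasDegree d (pad k ∘ H)
pad-degree {n = n} {k} H degree w with splitAt n w in eq
... | inj₁ v rewrite sym (splitAt⁻¹-↑ˡ eq) = ≤-trans (degreeAt-mono (pad k ∘ H) H v∈H) (degree v)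
  where
  v∈H : ∀ j → v ↑ˡ k ∈ pad k (H j) → v ∈ H j
  v∈H j v↑∈pad =
    let v′ , v′↑≡v↑ , v′∈H = ∈-pad⁻ (H j) v↑∈pad in subst (_∈ H j) (↑ˡ-injective k v′ v v′↑≡v↑) v′∈H
... | inj₂ t rewrite sym (splitAt⁻¹-↑ʳ eq) =
  subst (_≤ _) (sym (degreeAt-isolated (pad k ∘ H) (λ j → ↑ʳ-∉-pad (H j) t))) z≤n

completeCover⇒covered : ∀ {m k} {H : Family m (suc (suc k))} →
  EdgeCover (CompleteGraph (suc (suc k))) H → ∀ v u → Covered H v u
completeCover⇒covered cover v u with u ≟ v
... | no u≢v  = cover v u (u≢v ∘ sym)
... | yes refl = let j , v∈Hj , _ = cover v (punchIn v zero) (punchInᵢ≢i v zero ∘ sym) in j , v∈Hj , v∈Hj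

pad-notInvertible : ∀ {m k} (H : Family m (suc k)) → (∀ v u → Covered H v u) → ¬ Invertible (pad k ∘ H)
pad-notInvertible {k = k} H covers (π , disjoint) = contradiction (injective⇒≤ new-injective) 1+n≰n
  where
  old↦new : ∀ v → ∃[ t ] π ⟨$⟩ʳ (v ↑ˡ k) ≡ suc k ↑ʳ t
  old↦new v with splitAt (suc k) (π ⟨$⟩ʳ (v ↑ˡ k)) in eq
  ... | inj₂ t = t , sym (splitAt⁻¹-↑ʳ eq)
  ... | inj₁ u =
    let j , v∈Hj , u∈Hj = covers v u
        πv∈pad = subst (_∈ pad k (H j)) (splitAt⁻¹-↑ˡ eq) (↑ˡ-∈-pad u∈Hj)
    in contradiction (_ , (v ↑ˡ k , ↑ˡ-∈-pad v∈Hj , refl) , πv∈pad) (disjoint j)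

  new-injective : Injective _≡_ _≡_ (proj₁ ∘ old↦new)
  new-injective {v} {v′} t≡t′ = ↑ˡ-injective k v v′ (Injection.injective (↔⇒↣ π) (begin
    π ⟨$⟩ʳ (v ↑ˡ k)             ≡⟨ proj₂ (old↦new v) ⟩
    suc k ↑ʳ proj₁ (old↦new v)  ≡⟨ cong (suc k ↑ʳ_) t≡t′ ⟩
    suc k ↑ʳ proj₁ (old↦new v′) ≡⟨ proj₂ (old↦new v′) ⟨
    π ⟨$⟩ʳ (v′ ↑ˡ k)            ∎))
    where open ≡-Reasoning

module Swap {k} {x y : Fin (suc k)} (x≢y : x ≢ y) where

  swap : Fin (suc k) ⊎ Fin k → Fin (suc k) ⊎ Fin k
  swap (inj₁ v) with v ≟ x | v ≟ y
  ... | yes _   | _     = inj₁ y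
  ... | no  _   | yes _ = inj₁ x
  ... | no  v≢x | no  _ = inj₂ (punchOut (v≢x ∘ sym))
  swap (inj₂ t) with punchIn x t ≟ y
  ... | yes _ = inj₂ t
  ... | no  _ = inj₁ (punchIn x t)

  swap-x : swap (inj₁ x) ≡ inj₁ y
  swap-x with x ≟ x
  ... | yes _   = refl
  ... | no  x≢x = contradiction refl x≢x

  swap-y : swap (inj₁ y) ≡ inj₁ x
  swap-y with y ≟ x | y ≟ y
  ... | yes y≡x | _       = contradiction (sym y≡x) x≢y
  ... | no  _   | yes _   = refl
  ... | no  _   | no  y≢y = contradiction refl y≢y

  swap-old : ∀ {v} (v≢x : v ≢ x) → v ≢ y → swap (inj₁ v) ≡ inj₂ (punchOut (v≢x ∘ sym))
  swap-old {v} v≢x v≢y with v ≟ x | v ≟ y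
  ... | yes v≡x | _       = contradiction v≡x v≢x
  ... | no  _   | yes v≡y = contradiction v≡y v≢y
  ... | no  _   | no  _   = cong inj₂ (punchOut-cong x refl)

  swap-fixed : ∀ {t} → punchIn x t ≡ y → swap (inj₂ t) ≡ inj₂ t
  swap-fixed {t} eq with punchIn x t ≟ y
  ... | yes _  = refl
  ... | no neq = contradiction eq neq

  swap-new : ∀ {t} → punchIn x t ≢ y → swap (inj₂ t) ≡ inj₁ (punchIn x t)
  swap-new {t} neq with punchIn x t ≟ y
  ... | yes eq = contradiction eq neq
  ... | no _   = refl

  swap-involutive : ∀ a → swap (swap a) ≡ a
  swap-involutive (inj₁ v) with v ≟ x | v ≟ y
  ... | yes refl | _        = swap-y
  ... | no  _    | yes refl = swap-x
  ... | no  v≢x  | no  v≢y  =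
    trans (swap-new (λ eq → v≢y (trans (sym (punchIn-punchOut _)) eq))) (cong inj₁ (punchIn-punchOut _))
  swap-involutive (inj₂ t) with punchIn x t ≟ y
  ... | yes eq  = swap-fixed eq
  ... | no  neq =
    trans (swap-old (punchInᵢ≢i x t) neq) (cong inj₂ (trans (punchOut-cong x refl) (punchOut-punchIn x)))

  swap-old↦old : ∀ {v u} → swap (inj₁ v) ≡ inj₁ u → (v ≡ x × u ≡ y) ⊎ (v ≡ y × u ≡ x)
  swap-old↦old {v} eq with v ≟ x | v ≟ y | eq
  ... | yes v≡x | _       | refl = inj₁ (v≡x , refl)
  ... | no  _   | yes v≡y | refl = inj₂ (v≡y , refl)

  swapPermutation : Permutation′ (suc k + k)
  swapPermutation = permutation f f f-involutive f-involutive
    where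
    f : Fin (suc k + k) → Fin (suc k + k)
    f = join (suc k) k ∘ swap ∘ splitAt (suc k)

    f-involutive : ∀ w → f (f w) ≡ w
    f-involutive w = begin
      join (suc k) k (swap (splitAt (suc k) (join (suc k) k (swap (splitAt (suc k) w)))))
        ≡⟨ cong (join (suc k) k ∘ swap) (splitAt-join (suc k) k (swap (splitAt (suc k) w))) ⟩
      join (suc k) k (swap (swap (splitAt (suc k) w)))
        ≡⟨ cong (join (suc k) k) (swap-involutive (splitAt (suc k) w)) ⟩
      join (suc k) k (splitAt (suc k) w)
        ≡⟨ join-splitAt (suc k) k w ⟩
      w ∎
      where open ≡-Reasoning

  swapPermutation-old↦old : ∀ {v u} → swapPermutation ⟨$⟩ʳ (v ↑ˡ k) ≡ u ↑ˡ k →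
    (v ≡ x × u ≡ y) ⊎ (v ≡ y × u ≡ x)
  swapPermutation-old↦old {v} {u} eq = swap-old↦old (begin
    swap (inj₁ v)
      ≡⟨ cong swap (splitAt-↑ˡ (suc k) v k) ⟨
    swap (splitAt (suc k) (v ↑ˡ k))
      ≡⟨ splitAt-join (suc k) k (swap (splitAt (suc k) (v ↑ˡ k))) ⟨
    splitAt (suc k) (swapPermutation ⟨$⟩ʳ (v ↑ˡ k))
      ≡⟨ cong (splitAt (suc k)) eq ⟩
    splitAt (suc k) (u ↑ˡ k)
      ≡⟨ splitAt-↑ˡ (suc k) u k ⟩
    inj₁ u ∎)
    where open ≡-Reasoning

pad-invertibleWithout : ∀ {m k} (H : Family m (suc k)) → HasPrivateEdges (CompleteGraph (suc k)) H →
  ∀ j → InvertibleWithout (pad k ∘ H) j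
pad-invertibleWithout {k = k} H private-edges j₀ with private-edges j₀
... | x , y , x≢y , _ , _ , only-j₀ = swapPermutation , disjoint
  where
  open Swap x≢y
  disjoint : ∀ j → j ≢ j₀ → DisjointImage swapPermutation (pad k (H j))
  disjoint j j≢j₀ (_ , (_ , w∈pad , πw≡w′) , w′∈pad) with ∈-pad⁻ (H j) w∈pad | ∈-pad⁻ (H j) w′∈pad
  ... | v , refl , v∈Hj | u , refl , u∈Hj with swapPermutation-old↦old {v} {u} πw≡w′
  ...   | inj₁ (v≡x , u≡y) = j≢j₀ (only-j₀ j (subst (_∈ H j) v≡x v∈Hj) (subst (_∈ H j) u≡y u∈Hj))
  ...   | inj₂ (v≡y , u≡x) = j≢j₀ (only-j₀ j (subst (_∈ H j) u≡x u∈Hj) (subst (_∈ H j) v≡y v∈Hj))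

pad-critical : ∀ {m k d} (H : Family m (suc (suc k))) → IsSetFamily H → HasDegree d H →
  MinimalEdgeCover (CompleteGraph (suc (suc k))) H → IAttained d m
pad-critical {k = k} H set-family degree minimal =
  suc (suc k) + suc k , pad (suc k) ∘ H , set-family ∘ ++-injectiveˡ _ _ , pad-degree H degree ,
  pad-notInvertible H (completeCover⇒covered (proj₁ minimal)) ,
  pad-invertibleWithout H (minimal⇒privateEdges (λ x y → ¬? (x ≟ y)) minimal)

singleEdge-critical : ∀ {d} → 1 ≤ d → IAttained d 1
singleEdge-critical 1≤d = 1 , (λ _ → ⊤) , (λ { {zero} {zero} _ → refl }) , (λ { zero → 1≤d }) ,
  (λ (π , disjoint) → disjoint zero (_ , (zero , here , refl) , ∈⊤)) ,
  (λ { zero → Perm.id , λ { zero 0≢0 → contradiction refl 0≢0 } })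

minimal-edgeless⇒empty : ∀ {m n} {G : Graph n} {H : Family m n} →
  (∀ x y → ¬ G x y) → MinimalEdgeCover G H → m ≡ 0
minimal-edgeless⇒empty {zero}  _        _             = refl
minimal-edgeless⇒empty {suc m} edgeless (_ , minimal) =
  contradiction (λ x y xGy → contradiction xGy (edgeless x y)) (minimal ⊥ (zero , ∉⊥))

c≼i : ∀ {d} → 1 ≤ d → CAttained d ≼ IAttained d
c≼i 1≤d k (zero , _ , _ , _ , minimal) =
  1 , subst (_≤ 1) (sym (minimal-edgeless⇒empty (λ ()) minimal)) z≤n , singleEdge-critical 1≤d
c≼i 1≤d k (suc zero , _ , _ , _ , minimal) =
  1 , subst (_≤ 1) (sym (minimal-edgeless⇒empty (λ { zero zero 0≢0 → 0≢0 refl }) minimal)) z≤n ,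
  singleEdge-critical 1≤d
c≼i 1≤d k (suc (suc _) , H , set-family , degree , minimal) =
  k , ≤-refl , pad-critical H set-family degree minimal

-- i(d) ≤ b(d)

preimage : ∀ {n n′} → (Fin n′ → Fin n) → Subset n → Subset n′
preimage f E = ⟦ (λ v → f v ∈? E) ⟧

covered-preimage : ∀ {m n n′} (f : Fin n′ → Fin n) {H : Family m n} {u v} →
  Covered H (f u) (f v) → Covered (preimage f ∘ H) u v
covered-preimage f {H} (j , fu∈Hj , fv∈Hj) = j , ∈⟦⟧⁺ (λ v → f v ∈? H j) fu∈Hj , ∈⟦⟧⁺ (λ v → f v ∈? H j) fv∈Hj

privatePair-preimage : ∀ {m n n′} (f : Fin n′ → Fin n) {H : Family m n} {j u v} →
  PrivatePair H j (f u) (f v) → PrivatePair (preimage f ∘ H) j u v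
privatePair-preimage f {H} {j} (fu∈Hj , fv∈Hj , only-j) =
  ∈⟦⟧⁺ (λ v → f v ∈? H j) fu∈Hj , ∈⟦⟧⁺ (λ v → f v ∈? H j) fv∈Hj ,
  λ j′ u∈ v∈ → only-j j′ (∈⟦⟧⁻ (λ v → f v ∈? H j′) u∈) (∈⟦⟧⁻ (λ v → f v ∈? H j′) v∈)

degreeAt-preimage : ∀ {m n n′} (f : Fin n′ → Fin n) (H : Family m n) v →
  degreeAt (preimage f ∘ H) v ≤ degreeAt H (f v)
degreeAt-preimage f H v = degreeAt-mono (preimage f ∘ H) H (λ j → ∈⟦⟧⁻ (λ v → f v ∈? H j))

-- The two sides of K_{|X|,|Y|} are copies of X and Y, which may overlap in Fin n.
bipartiteRestriction : ∀ {m n d} (H : Family m n) (X Y : Subset n) → HasDegree d H →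
  (∀ {x y} → x ∈ X → y ∈ Y → Covered H x y) →
  (∀ j → ∃₂ λ x y → x ∈ X × y ∈ Y × PrivatePair H j x y) → BAttained d m
bipartiteRestriction H X Y degree cross-covered cross-private =
  ∣ X ∣ , ∣ Y ∣ , H′ , privateEdges⇒setFamily private-edges ,
  (λ v → ≤-trans (degreeAt-preimage orig H v) (degree (orig v))) ,
  privateEdges⇒minimal cover private-edges
  where
  orig : Fin (∣ X ∣ + ∣ Y ∣) → Fin _
  orig w = [ enum X , enum Y ]′ (splitAt ∣ X ∣ w)

  H′ : Family _ (∣ X ∣ + ∣ Y ∣)
  H′ = preimage orig ∘ H

  orig-left : ∀ w → IsLeft (splitAt ∣ X ∣ w) → orig w ∈ X
  orig-left w _ with splitAt ∣ X ∣ w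
  ... | inj₁ i = enum-∈ X i

  orig-right : ∀ w → ¬ IsLeft (splitAt ∣ X ∣ w) → orig w ∈ Y
  orig-right w right with splitAt ∣ X ∣ w
  ... | inj₁ _ = contradiction tt right
  ... | inj₂ i = enum-∈ Y i

  cover : EdgeCover (CompleteBipartiteGraph ∣ X ∣ ∣ Y ∣) H′
  cover u v (inj₁ (u-left , v-right)) =
    covered-preimage orig (cross-covered (orig-left u u-left) (orig-right v v-right))
  cover u v (inj₂ (u-right , v-left)) =
    let j , v∈H′j , u∈H′j = covered-preimage orig (cross-covered (orig-left v v-left) (orig-right u u-right))
    in j , u∈H′j , v∈H′j

  private-edges : HasPrivateEdges (CompleteBipartiteGraph ∣ X ∣ ∣ Y ∣) H′
  private-edges j with cross-private j
  ... | x , y , x∈X , y∈Y , private-xy = index X x∈X ↑ˡ ∣ Y ∣ , ∣ X ∣ ↑ʳ index Y y∈Y , edge ,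
    privatePair-preimage orig (subst₂ (PrivatePair H j) (sym orig-u) (sym orig-v) private-xy)
    where
    orig-u : orig (index X x∈X ↑ˡ ∣ Y ∣) ≡ x
    orig-u rewrite splitAt-↑ˡ (∣ X ∣) (index X x∈X) (∣ Y ∣) = enum-index X x∈X
    orig-v : orig (∣ X ∣ ↑ʳ index Y y∈Y) ≡ y
    orig-v rewrite splitAt-↑ʳ (∣ X ∣) (∣ Y ∣) (index Y y∈Y) = enum-index Y y∈Y
    edge : CompleteBipartiteGraph ∣ X ∣ ∣ Y ∣ (index X x∈X ↑ˡ ∣ Y ∣) (∣ X ∣ ↑ʳ index Y y∈Y)
    edge rewrite splitAt-↑ˡ (∣ X ∣) (index X x∈X) (∣ Y ∣) | splitAt-↑ʳ (∣ X ∣) (∣ Y ∣) (index Y y∈Y) =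
      inj₁ (tt , λ ())

module Separation {m n} (H : Family m n) where
  open Hall (λ x y → ¬ Covered H x y) (λ x y → ¬? (covered? H x y)) public

  matching⇒invertible : Matching ⊤ ⊤ → Invertible H
  matching⇒invertible M =
    let π , π≗match = injective⇒permutation (λ x → match (∈⊤ {x = x})) (match-injective ∈⊤ ∈⊤)
    in π , λ j → λ { (_ , (x , x∈Hj , refl) , πx∈Hj) →
                     match-related ∈⊤ (j , x∈Hj , subst (_∈ H j) (π≗match x) πx∈Hj) }
    where open Matching M

  cross-covered : ∀ X {x y} → x ∈ X → y ∈ ∁ (Nb ⊤ X) → Covered H x y
  cross-covered X {x} {y} x∈X y∈Y with covered? H x y
  ... | yes covered = covered
  ... | no ¬covered = contradiction (Nb⁺ ∈⊤ x∈X ¬covered) (x∈∁p⇒x∉p y∈Y)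

  privateCrossPair : ∀ {X j} → ∣ Nb ⊤ X ∣ < ∣ X ∣ → InvertibleWithout H j →
    ∃₂ λ x y → x ∈ X × y ∈ ∁ (Nb ⊤ X) × PrivatePair H j x y
  privateCrossPair {X} {j} X-deficient (π , disjoint) =
    let x , y , ¬coveredByOthers =
          ¬∀₂⟶∃₂¬ (λ x y → x ∈? X →-dec y ∈? Y →-dec coveredByOthers? x y) ¬allCoveredByOthers
        x∈X , ¬coveredByOthers′ = ¬→⇒×¬ (x ∈? X) ¬coveredByOthers
        y∈Y , ¬others            = ¬→⇒×¬ (y ∈? Y) ¬coveredByOthers′
    in x , y , x∈X , y∈Y , coveredOnlyBy⇒privatePair (cross-covered X x∈X y∈Y) ¬others
    where
    Y = ∁ (Nb ⊤ X)

    CoveredByOthers : Fin n → Fin n → Set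
    CoveredByOthers x y = ∃[ j′ ] (j′ ≢ j × x ∈ H j′ × y ∈ H j′)

    coveredByOthers? : Decidable CoveredByOthers
    coveredByOthers? x y = any? (λ j′ → ¬? (j′ ≟ j) ×-dec x ∈? H j′ ×-dec y ∈? H j′)

    ¬allCoveredByOthers : ¬ (∀ x y → x ∈ X → y ∈ Y → CoveredByOthers x y)
    ¬allCoveredByOthers covered =
      <⇒≱ X-deficient (injectiveOn⇒∣p∣≤∣q∣ (π ⟨$⟩ʳ_) π[X]⊆Nb (λ _ _ → Injection.injective (↔⇒↣ π)))
      where
      π[X]⊆Nb : ∀ {x} → x ∈ X → π ⟨$⟩ʳ x ∈ Nb ⊤ X
      π[X]⊆Nb {x} x∈X with π ⟨$⟩ʳ x ∈? Y
      ... | no  πx∉Y = x∉∁p⇒x∈p πx∉Y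
      ... | yes πx∈Y =
        let j′ , j′≢j , x∈Hj′ , πx∈Hj′ = covered x _ x∈X πx∈Y
        in contradiction (_ , (x , x∈Hj′ , refl) , πx∈Hj′) (disjoint j′ j′≢j)

critical⇒bipartite : ∀ {m n d} (H : Family m n) → HasDegree d H → InvertibilityCritical H → BAttained d m
critical⇒bipartite H degree (¬invertible , invertibleWithout) = fromHall (hall ⊤ ⊤)
  where
  open Separation H
  fromHall : Matching ⊤ ⊤ ⊎ Deficient ⊤ ⊤ → BAttained _ _
  fromHall (inj₁ M)                    = contradiction (matching⇒invertible M) ¬invertible
  fromHall (inj₂ (X , _ , X-deficient)) =
    bipartiteRestriction H X (∁ (Nb ⊤ X)) degree (cross-covered X)
      (λ j → privateCrossPair X-deficient (invertibleWithout j))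

i≼b : ∀ {d} → IAttained d ≼ BAttained d
i≼b k (_ , H , _ , degree , critical) = k , ≤-refl , critical⇒bipartite H degree critical

-- b(d) ≤ c(d + 1)

privateEdges-∷ : ∀ {m n} {G G′ : Graph n} {H : Family m n} {S a b} → HasPrivateEdges G H →
  (∀ {x y} → G x y → ¬ (x ∈ S × y ∈ S)) → G ⇒ G′ →
  G′ a b → a ∈ S → b ∈ S → ¬ Covered H a b → HasPrivateEdges G′ (S ∷ᶠ H)
privateEdges-∷ {a = a} {b} _ _ _ aG′b a∈S b∈S uncovered zero = a , b , aG′b , a∈S , b∈S , only-S
  where
  only-S : ∀ j → a ∈ (_ ∷ᶠ _) j → b ∈ (_ ∷ᶠ _) j → j ≡ zero
  only-S zero    _     _     = refl
  only-S (suc j) a∈Hj b∈Hj = contradiction (j , a∈Hj , b∈Hj) uncovered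
privateEdges-∷ private-edges G-avoids-S G⇒G′ _ _ _ _ (suc i) with private-edges i
... | x , y , xGy , x∈Hi , y∈Hi , only-i = x , y , G⇒G′ xGy , x∈Hi , y∈Hi , only-suc-i
  where
  only-suc-i : ∀ j → x ∈ (_ ∷ᶠ _) j → y ∈ (_ ∷ᶠ _) j → j ≡ suc i
  only-suc-i zero    x∈S  y∈S  = contradiction (x∈S , y∈S) (G-avoids-S xGy)
  only-suc-i (suc j) x∈Hj y∈Hj = cong suc (only-i j x∈Hj y∈Hj)

record CliqueExtension {m n} (G : Graph n) (H : Family m n) (S : Subset n) : Set where
  field
    size           : ℕ
    family         : Family size n
    m≤size         : m ≤ size
    private-edges  : HasPrivateEdges G family
    keeps-cover    : ∀ {x y} → Covered H x y → Covered family x y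
    covers-S       : ∀ {x y} → x ≢ y → x ∈ S → y ∈ S → Covered family x y
    degree-outside : ∀ {v} → v ∉ S → degreeAt family v ≤ degreeAt H v
    degree-inside  : ∀ v → degreeAt family v ≤ suc (degreeAt H v)

-- S becomes a new member exactly when some pair inside S is not yet covered; that pair is then
-- its private edge.
addClique : ∀ {m n} {G G′ : Graph n} {H : Family m n} (S : Subset n) → HasPrivateEdges G H →
  (∀ {x y} → G x y → ¬ (x ∈ S × y ∈ S)) → G ⇒ G′ → (∀ {x y} → x ≢ y → x ∈ S → y ∈ S → G′ x y) →
  CliqueExtension G′ H S
addClique {m = m} {H = H} S private-edges G-avoids-S G⇒G′ S-clique
  with any? (λ a → any? (λ b → ¬? (a ≟ b) ×-dec a ∈? S ×-dec b ∈? S ×-dec ¬? (covered? H a b)))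
... | yes (a , b , a≢b , a∈S , b∈S , uncovered) = record
  { size           = suc m
  ; family         = S ∷ᶠ H
  ; m≤size         = n≤1+n m
  ; private-edges  = privateEdges-∷ private-edges G-avoids-S G⇒G′ (S-clique a≢b a∈S b∈S) a∈S b∈S uncovered
  ; keeps-cover    = λ (j , x∈Hj , y∈Hj) → suc j , x∈Hj , y∈Hj
  ; covers-S       = λ _ x∈S y∈S → zero , x∈S , y∈S
  ; degree-outside = degreeAt-∷-∉ S H
  ; degree-inside  = degreeAt-∷ S H
  }
... | no ¬uncovered = record
  { size           = m
  ; family         = H
  ; m≤size         = ≤-refl
  ; private-edges  = privateEdges-mono G⇒G′ private-edges
  ; keeps-cover    = λ covered → covered
  ; covers-S       = covers-S
  ; degree-outside = λ _ → ≤-refl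
  ; degree-inside  = λ _ → n≤1+n _
  }
  where
  covers-S : ∀ {x y} → x ≢ y → x ∈ S → y ∈ S → Covered H x y
  covers-S {x} {y} x≢y x∈S y∈S with covered? H x y
  ... | yes covered = covered
  ... | no uncovered = contradiction (x , y , x≢y , x∈S , y∈S , uncovered) ¬uncovered

Bipartite : ∀ {n} → Subset n → Graph n
Bipartite S x y = (x ∈ S × y ∉ S) ⊎ (x ∉ S × y ∈ S)

bipartite⇒complete : ∀ {m n d} (S : Subset n) (H : Family m n) → HasDegree d H →
  EdgeCover (Bipartite S) H → HasPrivateEdges (Bipartite S) H → ∃[ m′ ] (m ≤ m′ × CAttained (suc d) m′)
bipartite⇒complete {n = n} S H degree cover private-edges =
  E₂.size , ≤-trans E₁.m≤size E₂.m≤size ,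
  n , E₂.family , privateEdges⇒setFamily E₂.private-edges , degree₂ ,
  privateEdges⇒minimal cover₂ E₂.private-edges
  where
  -- After adding S the private edges either cross or lie in S, so none lies inside ∁ S.
  NotInside∁ : Graph n
  NotInside∁ x y = x ≢ y × ¬ (x ∈ ∁ S × y ∈ ∁ S)

  bipartite⇒notInside∁ : Bipartite S ⇒ NotInside∁
  bipartite⇒notInside∁ (inj₁ (x∈S , y∉S)) = (λ { refl → y∉S x∈S }) , λ (x∈∁S , _) → x∈∁p⇒x∉p x∈∁S x∈S
  bipartite⇒notInside∁ (inj₂ (x∉S , y∈S)) = (λ { refl → x∉S y∈S }) , λ (_ , y∈∁S) → x∈∁p⇒x∉p y∈∁S y∈S

  E₁ : CliqueExtension NotInside∁ H S
  E₁ = addClique S private-edges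
         (λ { (inj₁ (_ , y∉S)) (_ , y∈S) → y∉S y∈S ; (inj₂ (x∉S , _)) (x∈S , _) → x∉S x∈S })
         bipartite⇒notInside∁ (λ x≢y x∈S _ → x≢y , λ (x∈∁S , _) → x∈∁p⇒x∉p x∈∁S x∈S)
  module E₁ = CliqueExtension E₁

  E₂ : CliqueExtension (CompleteGraph n) E₁.family (∁ S)
  E₂ = addClique (∁ S) E₁.private-edges proj₂ proj₁ (λ x≢y _ _ → x≢y)
  module E₂ = CliqueExtension E₂

  cover₂ : EdgeCover (CompleteGraph n) E₂.family
  cover₂ x y x≢y with x ∈? S | y ∈? S
  ... | yes x∈S | yes y∈S = E₂.keeps-cover (E₁.covers-S x≢y x∈S y∈S)
  ... | no  x∉S | no  y∉S = E₂.covers-S x≢y (x∉p⇒x∈∁p x∉S) (x∉p⇒x∈∁p y∉S)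
  ... | yes x∈S | no  y∉S = E₂.keeps-cover (E₁.keeps-cover (cover x y (inj₁ (x∈S , y∉S))))
  ... | no  x∉S | yes y∈S = E₂.keeps-cover (E₁.keeps-cover (cover x y (inj₂ (x∉S , y∈S))))

  degree₂ : HasDegree (suc _) E₂.family
  degree₂ v with v ∈? S
  ... | yes v∈S = ≤-trans (E₂.degree-outside (x∈p⇒x∉∁p v∈S)) (≤-trans (E₁.degree-inside v) (s≤s (degree v)))
  ... | no  v∉S = ≤-trans (E₂.degree-inside v) (s≤s (≤-trans (E₁.degree-outside v∉S) (degree v)))

isLeft? : ∀ {A B : Set} (s : A ⊎ B) → Dec (IsLeft s)
isLeft? (inj₁ _) = yes tt
isLeft? (inj₂ _) = no λ ()

leftPart : ∀ p q → Subset (p + q)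
leftPart p q = ⟦ (λ v → isLeft? (splitAt p v)) ⟧

completeBipartite⇒bipartite : ∀ {p q} → CompleteBipartiteGraph p q ⇒ Bipartite (leftPart p q)
completeBipartite⇒bipartite {p} {q} (inj₁ (x-left , y-right)) =
  inj₁ (∈⟦⟧⁺ (λ v → isLeft? (splitAt p v)) x-left , y-right ∘ ∈⟦⟧⁻ (λ v → isLeft? (splitAt p v)))
completeBipartite⇒bipartite {p} {q} (inj₂ (x-right , y-left)) =
  inj₂ (x-right ∘ ∈⟦⟧⁻ (λ v → isLeft? (splitAt p v)) , ∈⟦⟧⁺ (λ v → isLeft? (splitAt p v)) y-left)

bipartite⇒completeBipartite : ∀ {p q} → Bipartite (leftPart p q) ⇒ CompleteBipartiteGraph p q
bipartite⇒completeBipartite {p} {q} (inj₁ (x∈L , y∉L)) =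
  inj₁ (∈⟦⟧⁻ (λ v → isLeft? (splitAt p v)) x∈L , y∉L ∘ ∈⟦⟧⁺ (λ v → isLeft? (splitAt p v)))
bipartite⇒completeBipartite {p} {q} (inj₂ (x∉L , y∈L)) =
  inj₂ (x∉L ∘ ∈⟦⟧⁺ (λ v → isLeft? (splitAt p v)) , ∈⟦⟧⁻ (λ v → isLeft? (splitAt p v)) y∈L)

completeBipartite? : ∀ p q → Decidable (CompleteBipartiteGraph p q)
completeBipartite? p q x y =
  (isLeft? (splitAt p x) ×-dec ¬? (isLeft? (splitAt p y))) ⊎-dec
  (¬? (isLeft? (splitAt p x)) ×-dec isLeft? (splitAt p y))

b≼c : ∀ {d} → BAttained d ≼ CAttained (suc d)
b≼c k (p , q , H , _ , degree , minimal) =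
  bipartite⇒complete (leftPart p q) H degree (λ x y → proj₁ minimal x y ∘ bipartite⇒completeBipartite)
    (privateEdges-mono completeBipartite⇒bipartite (minimal⇒privateEdges (completeBipartite? p q) minimal))

theorem1p2 : ∀ (d : ℕ) → 1 ≤ d →
    (CAttained d ≼ IAttained d) × (IAttained d ≼ BAttained d) × (BAttained d ≼ CAttained (suc d))
theorem1p2 d 1≤d = c≼i 1≤d , i≼b , b≼c
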